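{- Let $n\ge 4$ and $k\ge 3$ be integers, and let $G\in\mathcal{G}(n,k)$ be $2$-edge-balanced. Then $n+1$ divides $2k(k-1)$.
   Context: Graphs are taken on the fixed vertex set $[n]=\{1,\dots,n\}$, and $K_n$ is the complete graph on $[n]$. For an integer $j\ge 0$, $\mathcal{G}(n,j)$ denotes the set of all graphs on $[n]$ with exactly $j$ edges. For $G\in\mathcal{G}(n,k)$ and an integer $t$ with $0<t<k$, $G$ is called $t$-edge-balanced if there is a positive integer $\lambda$ such that every $H\in\mathcal{G}(n,t)$ is contained in exactly $\lambda$ graphs $G'\in\mathcal{G}(n,k)$ that are isomorphic to $G$ and satisfy $E(H)\subseteq E(G')$. -}

module Defs where

open import Data.Bool using (Bool; true; false; T)
open import Data.Bool.Properties using (T?)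
open import Data.Nat using (ℕ; _<_; _≤_)
open import Data.Fin using (Fin) renaming (_<?_ to _<ᶠ?_)
open import Data.Fin.Permutation using (Permutation′; _⟨$⟩ʳ_)
open import Data.List using (List; length; filter; concatMap; map; allFin)
open import Data.List.Relation.Unary.All using (All)
open import Data.List.Relation.Unary.Any using (Any)
open import Data.List.Relation.Unary.AllPairs using (AllPairs)
open import Data.Product using (Σ; ∃; _×_; _,_; proj₁; proj₂)
open import Relation.Nullary using (¬_)
open import Relation.Binary.PropositionalEquality using (_≡_)

record Graph (n : ℕ) : Set where
  field
    adj   : Fin n → Fin n → Bool
    sym   : ∀ i j → adj i j ≡ adj j i
    irref : ∀ i → adj i i ≡ false
open Graph public

module _ {n : ℕ} where

  allPairs : List (Fin n × Fin n)
  allPairs = concatMap (λ i → map (λ j → (i , j)) (allFin n)) (allFin n)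

  edgeList : Graph n → List (Fin n × Fin n)
  edgeList G = filter (λ p → T? (adj G (proj₁ p) (proj₂ p)))
                      (filter (λ p → proj₁ p <ᶠ? proj₂ p) allPairs)

  numEdges : Graph n → ℕ
  numEdges G = length (edgeList G)

  _≈G_ : Graph n → Graph n → Set
  G ≈G G' = ∀ i j → adj G i j ≡ adj G' i j

  _⊆E_ : Graph n → Graph n → Set
  H ⊆E G = ∀ i j → T (adj H i j) → T (adj G i j)

  _≅_ : Graph n → Graph n → Set
  G ≅ G' = Σ (Permutation′ n) λ σ → ∀ i j → adj G' (σ ⟨$⟩ʳ i) (σ ⟨$⟩ʳ j) ≡ adj G i j

  -- the set of graphs on [n] satisfying P has exactly m elements
  -- (graphs counted up to equality of edge sets)
  HasExactly : ℕ → (Graph n → Set) → Set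
  HasExactly m P =
    Σ (List (Graph n)) λ L →
      length L ≡ m
      × All P L
      × AllPairs (λ a b → ¬ (a ≈G b)) L
      × (∀ G' → P G' → Any (λ a → G' ≈G a) L)

  EdgeBalanced : (t k : ℕ) → Graph n → Set
  EdgeBalanced t k G =
    numEdges G ≡ k × 0 < t × t < k ×
    Σ ℕ λ lam → 0 < lam ×
      (∀ (H : Graph n) → numEdges H ≡ t →
        HasExactly lam (λ G' → numEdges G' ≡ k × G ≅ G' × H ⊆E G'))

-- Double counting. Call X a copy of G if X ≅ G and X has k edges; by hypothesis
-- every two-edge graph H lies in exactly λ > 0 copies. Counting the pairs (H , X)
-- with H ⊆ X over all C(C(n,2),2) two-edge graphs H gives N·C(k,2) = C(C(n,2),2)·λ,
-- where N is the number of copies. Counting them over the n·C(n-1,2) cherries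
-- (two edges sharing a vertex) gives N·c = n·C(n-1,2)·λ, where c = Σ_v C(deg v,2)
-- is the number of cherries of G, an isomorphism invariant. Since
-- 4·C(C(n,2),2) = (n+1)·n·C(n-1,2), comparing the two (N ≠ 0 as λ ≠ 0) yields
-- (n+1)·c = 4·C(k,2) = 2k(k-1).
module Submission where

open import Defs hiding (sym)
open import Data.Nat.Properties
  using ( *-cancelˡ-≡; *-distribˡ-+; *-assoc; m*n≢0; m*n≢0⇒m≢0; ≤-trans; n≤1+n; ≤-antisym
        ; module ≤-Reasoning; +-0-commutativeMonoid; +-commutativeSemigroup; *-commutativeSemigroup )

open import Algebra.Properties.CommutativeMonoid.Sum +-0-commutativeMonoid
  using (sum-syntax; sum-cong-≗; sum-permute; sum-remove)
open import Algebra.Properties.CommutativeSemigroup *-commutativeSemigroup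
  using (x∙yz≈y∙xz; xy∙z≈zx∙y)
open import Algebra.Properties.CommutativeSemigroup +-commutativeSemigroup
  using (interchange)
open import Data.Bool using (Bool; true; false; T; not; _∧_; _∨_)
open import Data.Bool.Properties using (T?; T-∧; T-∨)
import Data.Bool.Properties as Bool
open import Data.Empty using (⊥-elim)
open import Data.Fin using (Fin; _≟_; punchIn) renaming (_<_ to _<ᶠ_; _<?_ to _<ᶠ?_)
import Data.Fin as Fin
open import Data.Fin.Permutation using (_⟨$⟩ʳ_)
open import Data.Fin.Properties using (<-cmp; <⇒≢; <-asym; all?; punchInᵢ≢i; punchIn-injective)
import Data.List as List
open import Data.List
  using (List; []; _∷_; _++_; map; length; filter; concatMap; tabulate; allFin; cartesianProduct; deduplicate)
open import Data.List.Properties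
  using (map-++; map-∘; map-cong; map-cong-local; length-++; length-map; length-tabulate; length-removeAt′)
open import Data.List.Membership.Propositional using (_∈_)
open import Data.List.Membership.Propositional.Properties using (∈-filter⁺; ∈-cartesianProduct⁺; ∈-allFin)
import Data.List.Membership.Setoid as SetoidMembership
import Data.List.Membership.Setoid.Properties as SetoidMembershipₚ
open import Data.List.Relation.Unary.All as All using (All; []; _∷_)
import Data.List.Relation.Unary.All.Properties as Allₚ
open import Data.List.Relation.Unary.AllPairs using (AllPairs; []; _∷_)
import Data.List.Relation.Unary.AllPairs.Properties as AllPairsₚ
open import Data.List.Relation.Unary.Any as Any using (Any; here; there; index; _─_)
import Data.List.Relation.Unary.Any.Properties as Anyₚ
open import Data.List.Relation.Unary.Unique.Propositional using (Unique)
import Data.List.Relation.Unary.Unique.Propositional.Properties as Uniqueₚ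
import Data.List.Relation.Unary.Unique.Setoid as SetoidUnique
import Data.List.Relation.Unary.Unique.Setoid.Properties as SetoidUniqueₚ
open import Data.List.Relation.Unary.Unique.DecSetoid.Properties using (deduplicate-!)
open import Data.Nat using (ℕ; zero; suc; _+_; _*_; _∸_; _≤_; _<_; s≤s; z≤n; NonZero; >-nonZero)
import Data.Nat as ℕ
open import Data.Nat.Combinatorics using (_C_; nC1≡n; nCk+nC[k+1]≡[n+1]C[k+1])
open import Data.Nat.Divisibility using (_∣_; divides)
open import Data.Nat.ListAction using (sum)
open import Data.Nat.ListAction.Properties using (sum-++)
open import Data.Nat.Tactic.RingSolver using (solve)
open import Data.Product using (_×_; _,_; proj₁; proj₂; uncurry)
open import Data.Product.Properties using (≡-dec)
open import Data.Sum using (_⊎_; inj₁; inj₂)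
import Data.Sum as Sum
open import Data.Unit using (tt)
open import Function using (_∘_; flip; mk⇔; Equivalence)
open import Relation.Binary using (Setoid; DecSetoid; Decidable; DecidableEquality; _Respects_; tri<; tri≈; tri>)
open import Relation.Binary.PropositionalEquality
open import Relation.Nullary using (Dec; yes; no; does; ¬_; contradiction; _×-dec_; _⊎-dec_; _→-dec_)
open import Relation.Nullary.Decidable using (does-⇔; dec-true; dec-false)

-- Binomial coefficients n C 2

[1+n]C2≡n+nC2 : ∀ n → suc n C 2 ≡ n + n C 2
[1+n]C2≡n+nC2 n = begin
  suc n C 2        ≡⟨ nCk+nC[k+1]≡[n+1]C[k+1] n 1 ⟨
  n C 1 + n C 2    ≡⟨ cong (_+ n C 2) (nC1≡n n) ⟩
  n + n C 2        ∎
  where open ≡-Reasoning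

2*[1+n]C2≡[1+n]*n : ∀ n → 2 * (suc n C 2) ≡ suc n * n
2*[1+n]C2≡[1+n]*n zero    = refl
2*[1+n]C2≡[1+n]*n (suc n) = begin
  2 * (suc (suc n) C 2)          ≡⟨ cong (2 *_) ([1+n]C2≡n+nC2 (suc n)) ⟩
  2 * (suc n + suc n C 2)        ≡⟨ *-distribˡ-+ 2 (suc n) (suc n C 2) ⟩
  2 * suc n + 2 * (suc n C 2)    ≡⟨ cong (2 * suc n +_) (2*[1+n]C2≡[1+n]*n n) ⟩
  2 * suc n + suc n * n          ≡⟨ solve List.[ n ] ⟩
  suc (suc n) * suc n            ∎
  where open ≡-Reasoning

2*n*[n∸1]≡4*nC2 : ∀ n → 2 * n * (n ∸ 1) ≡ 4 * (n C 2)
2*n*[n∸1]≡4*nC2 zero    = refl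
2*n*[n∸1]≡4*nC2 (suc n) = begin
  2 * suc n * n           ≡⟨ *-assoc 2 (suc n) n ⟩
  2 * (suc n * n)         ≡⟨ cong (2 *_) (2*[1+n]C2≡[1+n]*n n) ⟨
  2 * (2 * (suc n C 2))   ≡⟨ *-assoc 2 2 (suc n C 2) ⟨
  4 * (suc n C 2)         ∎
  where open ≡-Reasoning

nC2>0 : ∀ {n} → 2 ≤ n → 0 < n C 2
nC2>0 {suc zero}    (s≤s ())
nC2>0 {suc (suc n)} _ = subst (0 <_) (sym ([1+n]C2≡n+nC2 (suc n))) (s≤s z≤n)

4*[[1+n]C2]C2≡[2+n]*[1+n]*nC2 : ∀ n → 4 * ((suc n C 2) C 2) ≡ suc (suc n) * (suc n * (n C 2))
4*[[1+n]C2]C2≡[2+n]*[1+n]*nC2 zero    = refl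
4*[[1+n]C2]C2≡[2+n]*[1+n]*nC2 (suc n) = *-cancelˡ-≡ _ _ 2 (begin
  2 * (4 * ((suc (suc n) C 2) C 2))  ≡⟨ cong (λ x → 2 * (4 * (x C 2))) ([1+n]C2≡n+nC2 (suc n)) ⟩
  2 * (4 * (suc (n + a) C 2))        ≡⟨ x∙yz≈y∙xz 2 4 (suc (n + a) C 2) ⟩
  4 * (2 * (suc (n + a) C 2))        ≡⟨ cong (4 *_) (2*[1+n]C2≡[1+n]*n (n + a)) ⟩
  4 * (suc (n + a) * (n + a))        ≡⟨ polynomial n a (2*[1+n]C2≡[1+n]*n n) ⟩
  2 * ((3 + n) * ((2 + n) * a))      ∎)
  where
  open ≡-Reasoning
  a = suc n C 2
  polynomial : ∀ n a → 2 * a ≡ suc n * n → 4 * (suc (n + a) * (n + a)) ≡ 2 * ((3 + n) * ((2 + n) * a))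
  polynomial n a 2a≡[1+n]n = begin
    4 * (suc (n + a) * (n + a))                    ≡⟨ solve (n List.∷ List.[ a ]) ⟩
    (2 + 2 * n + 2 * a) * (2 * n + 2 * a)          ≡⟨ cong (λ t → (2 + 2 * n + t) * (2 * n + t)) 2a≡[1+n]n ⟩
    (2 + 2 * n + suc n * n) * (2 * n + suc n * n)  ≡⟨ solve List.[ n ] ⟩
    (3 + n) * ((2 + n) * (suc n * n))              ≡⟨ cong (λ t → (3 + n) * ((2 + n) * t)) 2a≡[1+n]n ⟨
    (3 + n) * ((2 + n) * (2 * a))                  ≡⟨ solve (n List.∷ List.[ a ]) ⟩
    2 * ((3 + n) * ((2 + n) * a))                  ∎

proportional : ∀ {N a b P Q c r s} → .{{NonZero P}} → .{{NonZero c}} →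
               N * a ≡ P * c → N * b ≡ Q * c → s * Q ≡ r * P → a * r ≡ s * b
proportional {N} {a} {b} {P} {Q} {c} {r} {s} Na≡Pc Nb≡Qc sQ≡rP =
  *-cancelˡ-≡ (a * r) (s * b) N ⦃ N≢0 ⦄ (begin
    N * (a * r)     ≡⟨ *-assoc N a r ⟨
    N * a * r       ≡⟨ cong (_* r) Na≡Pc ⟩
    P * c * r       ≡⟨ xy∙z≈zx∙y P c r ⟩
    r * P * c       ≡⟨ cong (_* c) sQ≡rP ⟨
    s * Q * c       ≡⟨ *-assoc s Q c ⟩
    s * (Q * c)     ≡⟨ cong (s *_) Nb≡Qc ⟨
    s * (N * b)     ≡⟨ x∙yz≈y∙xz s N b ⟩
    N * (s * b)     ∎)
  where
  open ≡-Reasoning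
  N≢0 : NonZero N
  N≢0 = m*n≢0⇒m≢0 N ⦃ subst NonZero (sym Na≡Pc) (m*n≢0 P c) ⦄

-- Counting in lists

𝟙 : Bool → ℕ
𝟙 true  = 1
𝟙 false = 0

𝟙-∨ : ∀ a b → ¬ T (a ∧ b) → 𝟙 (a ∨ b) ≡ 𝟙 a + 𝟙 b
𝟙-∨ true  true  not-both = ⊥-elim (not-both _)
𝟙-∨ true  false _        = refl
𝟙-∨ false b     _        = refl

T-does⁻ : ∀ {P : Set} (P? : Dec P) → T (does P?) → P
T-does⁻ (yes p) _ = p

T-does⁺ : ∀ {P : Set} (P? : Dec P) → P → T (does P?)
T-does⁺ (yes _) _ = _
T-does⁺ (no ¬p) p = ¬p p

Any×All⇒Any : ∀ {A : Set} {P Q : A → Set} {xs} → Any P xs → All Q xs → Any (λ x → P x × Q x) xs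
Any×All⇒Any (here px) (qx ∷ _)  = here (px , qx)
Any×All⇒Any (there p) (_ ∷ qxs) = there (Any×All⇒Any p qxs)

module _ {A : Set} where

  count : (A → Bool) → List A → ℕ
  count p xs = sum (map (𝟙 ∘ p) xs)

  sum-map-+ : ∀ (f g : A → ℕ) xs → sum (map (λ x → f x + g x) xs) ≡ sum (map f xs) + sum (map g xs)
  sum-map-+ f g []       = refl
  sum-map-+ f g (x ∷ xs) = trans (cong (f x + g x +_) (sum-map-+ f g xs)) (interchange (f x) (g x) _ _)

  sum-map-const : ∀ {f : A → ℕ} {c xs} → All (λ x → f x ≡ c) xs → sum (map f xs) ≡ length xs * c
  sum-map-const []          = refl
  sum-map-const (fx≡c ∷ ps) = cong₂ _+_ fx≡c (sum-map-const ps)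

  sum-map-zero : ∀ (xs : List A) → sum (map (λ _ → 0) xs) ≡ 0
  sum-map-zero []       = refl
  sum-map-zero (_ ∷ xs) = sum-map-zero xs

  count-≡0 : ∀ {p : A → Bool} {xs} → All (λ x → p x ≡ false) xs → count p xs ≡ 0
  count-≡0 []           = refl
  count-≡0 (px≡false ∷ ps) = cong₂ _+_ (cong 𝟙 px≡false) (count-≡0 ps)

  count-cong : ∀ {p q : A → Bool} {xs} → All (λ x → p x ≡ q x) xs → count p xs ≡ count q xs
  count-cong eqs = cong sum (map-cong-local (All.map (cong 𝟙) eqs))

  count-++ : ∀ (p : A → Bool) xs ys → count p (xs ++ ys) ≡ count p xs + count p ys
  count-++ p xs ys = trans (cong sum (map-++ (𝟙 ∘ p) xs ys)) (sum-++ (map (𝟙 ∘ p) xs) _)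

  count-∨ : ∀ (p q : A → Bool) xs → All (λ x → ¬ T (p x ∧ q x)) xs →
            count (λ x → p x ∨ q x) xs ≡ count p xs + count q xs
  count-∨ p q xs disjoint =
    trans (cong sum (map-cong-local (All.map (λ {x} → 𝟙-∨ (p x) (q x)) disjoint)))
          (sum-map-+ (𝟙 ∘ p) (𝟙 ∘ q) xs)

  count>0⇒Any : ∀ (p : A → Bool) xs → 0 < count p xs → Any (T ∘ p) xs
  count>0⇒Any p (x ∷ xs) pos with p x in px
  ... | true  = here (subst T (sym px) tt)
  ... | false = there (count>0⇒Any p xs pos)

  length-filter≡count : ∀ {P : A → Set} (P? : ∀ x → Dec (P x)) xs →
                        length (filter P? xs) ≡ count (does ∘ P?) xs
  length-filter≡count P? []       = refl
  length-filter≡count P? (x ∷ xs) with does (P? x)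
  ... | true  = cong suc (length-filter≡count P? xs)
  ... | false = length-filter≡count P? xs

  count-≟-unique : ∀ (_≟ᴬ_ : DecidableEquality A) {x xs} → Unique xs → x ∈ xs →
                   count (λ y → does (y ≟ᴬ x)) xs ≡ 1
  count-≟-unique _≟ᴬ_ {x} (x≢xs ∷ _) (here refl) =
    cong₂ _+_ (cong 𝟙 (dec-true (x ≟ᴬ x) refl))
              (count-≡0 (All.map (λ {z} x≢z → dec-false (z ≟ᴬ x) (x≢z ∘ sym)) x≢xs))
  count-≟-unique _≟ᴬ_ {x} {y ∷ _} (y≢ys ∷ u) (there x∈ys) =
    cong₂ _+_ (cong 𝟙 (dec-false (y ≟ᴬ x) (All.lookup y≢ys x∈ys))) (count-≟-unique _≟ᴬ_ u x∈ys)

module _ {A B : Set} where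

  count-map : ∀ (p : B → Bool) (f : A → B) xs → count p (map f xs) ≡ count (p ∘ f) xs
  count-map p f xs = cong sum (sym (map-∘ xs))

  sum-map-concatMap : ∀ (f : B → ℕ) (g : A → List B) xs →
                      sum (map f (concatMap g xs)) ≡ sum (map (λ x → sum (map f (g x))) xs)
  sum-map-concatMap f g []       = refl
  sum-map-concatMap f g (x ∷ xs) = begin
    sum (map f (g x ++ concatMap g xs))
      ≡⟨ cong sum (map-++ f (g x) _) ⟩
    sum (map f (g x) ++ map f (concatMap g xs))
      ≡⟨ sum-++ (map f (g x)) _ ⟩
    sum (map f (g x)) + sum (map f (concatMap g xs))
      ≡⟨ cong (sum (map f (g x)) +_) (sum-map-concatMap f g xs) ⟩
    sum (map f (g x)) + sum (map (λ x → sum (map f (g x))) xs) ∎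
    where open ≡-Reasoning

  length-concatMap : ∀ (g : A → List B) xs → length (concatMap g xs) ≡ sum (map (length ∘ g) xs)
  length-concatMap g []       = refl
  length-concatMap g (x ∷ xs) = trans (length-++ (g x)) (cong (length (g x) +_) (length-concatMap g xs))

  sum-map-swap : ∀ (f : A → B → ℕ) xs ys →
                 sum (map (λ x → sum (map (f x) ys)) xs) ≡ sum (map (λ y → sum (map (flip f y) xs)) ys)
  sum-map-swap f []       ys = sym (sum-map-zero ys)
  sum-map-swap f (x ∷ xs) ys = begin
    sum (map (f x) ys) + sum (map (λ x → sum (map (f x) ys)) xs)
      ≡⟨ cong (sum (map (f x) ys) +_) (sum-map-swap f xs ys) ⟩
    sum (map (f x) ys) + sum (map (λ y → sum (map (flip f y) xs)) ys)
      ≡⟨ sum-map-+ (f x) (λ y → sum (map (flip f y) xs)) ys ⟨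
    sum (map (λ y → f x y + sum (map (flip f y) xs)) ys) ∎
    where open ≡-Reasoning

  double-count : ∀ (r : A → B → Bool) {xs ys c d} →
                 All (λ x → count (r x) ys ≡ c) xs → All (λ y → count (flip r y) xs ≡ d) ys →
                 length xs * c ≡ length ys * d
  double-count r {xs} {ys} {c} {d} rows columns = begin
    length xs * c                              ≡⟨ sum-map-const rows ⟨
    sum (map (λ x → count (r x) ys) xs)        ≡⟨ sum-map-swap (λ x y → 𝟙 (r x y)) xs ys ⟩
    sum (map (λ y → count (flip r y) xs) ys)   ≡⟨ sum-map-const columns ⟩
    length ys * d                              ∎
    where open ≡-Reasoning

sum-map-tabulate : ∀ {A : Set} {n} (f : A → ℕ) (g : Fin n → A) →
                   sum (map f (tabulate g)) ≡ ∑[ i < n ] f (g i)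
sum-map-tabulate {n = zero}  f g = refl
sum-map-tabulate {n = suc n} f g = cong (f (g Fin.zero) +_) (sum-map-tabulate f (g ∘ Fin.suc))

∑[i<n]1≡n : ∀ n → ∑[ i < n ] 1 ≡ n
∑[i<n]1≡n zero    = refl
∑[i<n]1≡n (suc n) = cong suc (∑[i<n]1≡n n)

∑[i<n]∑[j<n][i<j]≡nC2 : ∀ n → ∑[ i < n ] ∑[ j < n ] 𝟙 (does (i <ᶠ? j)) ≡ n C 2
∑[i<n]∑[j<n][i<j]≡nC2 zero    = refl
∑[i<n]∑[j<n][i<j]≡nC2 (suc n) =
  trans (cong₂ _+_ (∑[i<n]1≡n n) (∑[i<n]∑[j<n][i<j]≡nC2 n)) (sym ([1+n]C2≡n+nC2 n))

module _ {A : Set} where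

  pairs : List A → List (A × A)
  pairs []       = []
  pairs (x ∷ xs) = map (x ,_) xs ++ pairs xs

  length-pairs : ∀ (xs : List A) → length (pairs xs) ≡ length xs C 2
  length-pairs []       = refl
  length-pairs (x ∷ xs) = begin
    length (map (x ,_) xs ++ pairs xs)           ≡⟨ length-++ (map (x ,_) xs) ⟩
    length (map (x ,_) xs) + length (pairs xs)   ≡⟨ cong₂ _+_ (length-map (x ,_) xs) (length-pairs xs) ⟩
    length xs + length xs C 2                    ≡⟨ [1+n]C2≡n+nC2 (length xs) ⟨
    suc (length xs) C 2                          ∎
    where open ≡-Reasoning

  count-pairs : ∀ (p : A → Bool) xs → count (uncurry (λ x y → p x ∧ p y)) (pairs xs) ≡ count p xs C 2
  count-pairs p []       = refl
  count-pairs p (x ∷ xs) = begin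
    count both (map (x ,_) xs ++ pairs xs)
      ≡⟨ count-++ both (map (x ,_) xs) (pairs xs) ⟩
    count both (map (x ,_) xs) + count both (pairs xs)
      ≡⟨ cong₂ _+_ (count-map both (x ,_) xs) (count-pairs p xs) ⟩
    count (λ y → p x ∧ p y) xs + count p xs C 2
      ≡⟨ with-x (p x) ⟩
    (𝟙 (p x) + count p xs) C 2 ∎
    where
    open ≡-Reasoning
    both : A × A → Bool
    both = uncurry (λ x y → p x ∧ p y)
    with-x : ∀ b → count (λ y → b ∧ p y) xs + count p xs C 2 ≡ (𝟙 b + count p xs) C 2
    with-x true  = sym ([1+n]C2≡n+nC2 (count p xs))
    with-x false = cong (_+ count p xs C 2) (sum-map-zero xs)

  All-pairs⁺ : ∀ {P : A → Set} {R : A → A → Set} {xs} → All P xs → AllPairs R xs →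
               All (uncurry (λ x y → P x × P y × R x y)) (pairs xs)
  All-pairs⁺ {xs = []}     []         []         = []
  All-pairs⁺ {xs = x ∷ xs} (px ∷ pxs) (rx ∷ rxs) =
    Allₚ.++⁺ (Allₚ.map⁺ (All.zipWith (px ,_) (pxs , rx))) (All-pairs⁺ pxs rxs)

module _ {c ℓ} (S : Setoid c ℓ) where
  open Setoid S using (_≈_) renaming (refl to ≈-refl; sym to ≈-sym; trans to ≈-trans)
  open SetoidMembership S using () renaming (_∈_ to _∈ₛ_)
  open SetoidUnique S using () renaming (Unique to Uniqueₛ)
  open SetoidMembershipₚ using (All[≉]⇒∉; ∈-resp-≈)

  ∈-─⁺ : ∀ {x y ys} (x∈ys : x ∈ₛ ys) → y ∈ₛ ys → ¬ x ≈ y → y ∈ₛ (ys ─ x∈ys)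
  ∈-─⁺ (here x≈z)   (here y≈z)   x≉y = contradiction (≈-trans x≈z (≈-sym y≈z)) x≉y
  ∈-─⁺ (here _)     (there y∈ys) _   = y∈ys
  ∈-─⁺ (there _)    (here y≈z)   _   = here y≈z
  ∈-─⁺ (there x∈ys) (there y∈ys) x≉y = there (∈-─⁺ x∈ys y∈ys x≉y)

  unique-⊆⇒length-≤ : ∀ {xs ys} → Uniqueₛ xs → (∀ x → x ∈ₛ xs → x ∈ₛ ys) → length xs ≤ length ys
  unique-⊆⇒length-≤ {[]}     _          _     = z≤n
  unique-⊆⇒length-≤ {x ∷ xs} {ys} (x≉xs ∷ u) xs⊆ys = begin
    suc (length xs)           ≤⟨ s≤s (unique-⊆⇒length-≤ u xs⊆ys─x) ⟩
    suc (length (ys ─ x∈ys))  ≡⟨ length-removeAt′ ys (index x∈ys) ⟨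
    length ys                 ∎
    where
    open ≤-Reasoning
    x∈ys : x ∈ₛ ys
    x∈ys = xs⊆ys x (here ≈-refl)
    xs⊆ys─x : ∀ y → y ∈ₛ xs → y ∈ₛ (ys ─ x∈ys)
    xs⊆ys─x y y∈xs = ∈-─⁺ x∈ys (xs⊆ys y (there y∈xs))
                           λ x≈y → All[≉]⇒∉ S x≉xs (∈-resp-≈ S (≈-sym x≈y) y∈xs)

  unique-⊆⊇⇒length-≡ : ∀ {xs ys} → Uniqueₛ xs → Uniqueₛ ys →
                       (∀ x → x ∈ₛ xs → x ∈ₛ ys) → (∀ y → y ∈ₛ ys → y ∈ₛ xs) →
                       length xs ≡ length ys
  unique-⊆⊇⇒length-≡ uxs uys xs⊆ys ys⊆xs =
    ≤-antisym (unique-⊆⇒length-≤ uxs xs⊆ys) (unique-⊆⇒length-≤ uys ys⊆xs)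

-- Two-edge graphs

module _ {n : ℕ} where

  adjᵉ : Graph n → Fin n × Fin n → Bool
  adjᵉ G e = adj G (proj₁ e) (proj₂ e)

  NonLoop : Fin n × Fin n → Set
  NonLoop e = proj₁ e ≢ proj₂ e

  infix 4 _≐_ _≐?_

  _≐_ : Fin n × Fin n → Fin n × Fin n → Set
  (a , b) ≐ (c , d) = (a ≡ c × b ≡ d) ⊎ (a ≡ d × b ≡ c)

  _≐?_ : ∀ e f → Dec (e ≐ f)
  (a , b) ≐? (c , d) = ((a ≟ c) ×-dec (b ≟ d)) ⊎-dec ((a ≟ d) ×-dec (b ≟ c))

  ≐-refl : ∀ {e} → e ≐ e
  ≐-refl = inj₁ (refl , refl)

  ≐-swapˡ : ∀ {a b e} → (a , b) ≐ e → (b , a) ≐ e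
  ≐-swapˡ (inj₁ (a≡c , b≡d)) = inj₂ (b≡d , a≡c)
  ≐-swapˡ (inj₂ (a≡d , b≡c)) = inj₁ (b≡c , a≡d)

  ≐-swapʳ : ∀ {e c d} → e ≐ (c , d) → e ≐ (d , c)
  ≐-swapʳ (inj₁ (a≡c , b≡d)) = inj₂ (a≡c , b≡d)
  ≐-swapʳ (inj₂ (a≡d , b≡c)) = inj₁ (a≡d , b≡c)

  ≐-unique : ∀ {p e f} → p ≐ e → p ≐ f → e ≐ f
  ≐-unique (inj₁ (refl , refl)) p≐f = p≐f
  ≐-unique (inj₂ (refl , refl)) p≐f = ≐-swapˡ p≐f

  ≐⇒≡ : ∀ {e f} → proj₁ e <ᶠ proj₂ e → proj₁ f <ᶠ proj₂ f → e ≐ f → e ≡ f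
  ≐⇒≡ _  _  (inj₁ (refl , refl)) = refl
  ≐⇒≡ e< f< (inj₂ (refl , refl)) = contradiction e< (<-asym f<)

  adjᵉ-resp-≐ : ∀ (X : Graph n) {e f} → e ≐ f → adjᵉ X e ≡ adjᵉ X f
  adjᵉ-resp-≐ X (inj₁ (refl , refl)) = refl
  adjᵉ-resp-≐ X (inj₂ (refl , refl)) = Graph.sym X _ _

  joins : Fin n × Fin n → Fin n × Fin n → Bool
  joins e p = does (p ≐? e)

  -- The guard x ≢ y keeps the graph irreflexive even when e or f is a loop.
  twoEdgeGraph : Fin n × Fin n → Fin n × Fin n → Graph n
  twoEdgeGraph e f = record
    { adj   = λ x y → not (does (x ≟ y)) ∧ joinsEither x y
    ; sym   = λ x y → cong₂ (λ b c → not b ∧ c) (does-⇔ (mk⇔ sym sym) (x ≟ y) (y ≟ x))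
                        (cong₂ _∨_ (joins-swap e x y) (joins-swap f x y))
    ; irref = λ x → cong (λ b → not b ∧ joinsEither x x) (dec-true (x ≟ x) refl)
    }
    where
    joinsEither : Fin n → Fin n → Bool
    joinsEither x y = joins e (x , y) ∨ joins f (x , y)
    joins-swap : ∀ e x y → joins e (x , y) ≡ joins e (y , x)
    joins-swap e x y = does-⇔ (mk⇔ ≐-swapˡ ≐-swapˡ) ((x , y) ≐? e) ((y , x) ≐? e)

  adjᵉ-twoEdgeGraph : ∀ {e f p} → NonLoop p → adjᵉ (twoEdgeGraph e f) p ≡ (joins e p ∨ joins f p)
  adjᵉ-twoEdgeGraph {e} {f} {x , y} x≢y =
    cong (λ b → not b ∧ (joins e (x , y) ∨ joins f (x , y))) (dec-false (x ≟ y) x≢y)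

  slots : List (Fin n × Fin n)
  slots = filter (λ p → proj₁ p <ᶠ? proj₂ p) allPairs

  numEdges≡count : ∀ G → numEdges G ≡ count (adjᵉ G) slots
  numEdges≡count G = length-filter≡count (λ p → T? (adjᵉ G p)) slots

  slots-increasing : All (λ p → proj₁ p <ᶠ proj₂ p) slots
  slots-increasing = Allₚ.all-filter (λ p → proj₁ p <ᶠ? proj₂ p) allPairs

  allPairs≡cartesianProduct : allPairs ≡ cartesianProduct (allFin n) (allFin n)
  allPairs≡cartesianProduct = go (allFin n)
    where
    go : ∀ xs → concatMap (λ i → map (λ j → (i , j)) (allFin n)) xs ≡ cartesianProduct xs (allFin n)
    go []       = refl
    go (x ∷ xs) = cong (map (x ,_) (allFin n) ++_) (go xs)

  slots-unique : Unique slots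
  slots-unique = Uniqueₚ.filter⁺ _ (subst Unique (sym allPairs≡cartesianProduct)
                   (Uniqueₚ.cartesianProduct⁺ (Uniqueₚ.allFin⁺ n) (Uniqueₚ.allFin⁺ n)))

  ∈-slots⁺ : ∀ {a b} → a <ᶠ b → (a , b) ∈ slots
  ∈-slots⁺ {a} {b} = ∈-filter⁺ (λ p → proj₁ p <ᶠ? proj₂ p)
    (subst ((a , b) ∈_) (sym allPairs≡cartesianProduct) (∈-cartesianProduct⁺ (∈-allFin a) (∈-allFin b)))

  length-slots : length slots ≡ n C 2
  length-slots = begin
    length slots
      ≡⟨ length-filter≡count (λ p → proj₁ p <ᶠ? proj₂ p) (allPairs {n}) ⟩
    count increasing (allPairs {n})
      ≡⟨ sum-map-concatMap (𝟙 ∘ increasing) row (allFin n) ⟩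
    sum (map (λ i → count increasing (row i)) (allFin n))
      ≡⟨ cong sum (map-cong count-row (allFin n)) ⟩
    sum (map (λ i → ∑[ j < n ] 𝟙 (does (i <ᶠ? j))) (allFin n))
      ≡⟨ sum-map-tabulate (λ i → ∑[ j < n ] 𝟙 (does (i <ᶠ? j))) (λ (i : Fin n) → i) ⟩
    ∑[ i < n ] ∑[ j < n ] 𝟙 (does (i <ᶠ? j))
      ≡⟨ ∑[i<n]∑[j<n][i<j]≡nC2 n ⟩
    n C 2 ∎
    where
    open ≡-Reasoning
    increasing : Fin n × Fin n → Bool
    increasing p = does (proj₁ p <ᶠ? proj₂ p)
    row : Fin n → List (Fin n × Fin n)
    row i = map (λ j → (i , j)) (allFin n)
    count-row : ∀ i → count increasing (row i) ≡ ∑[ j < n ] 𝟙 (does (i <ᶠ? j))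
    count-row i = trans (count-map increasing (i ,_) (allFin n))
                        (sum-map-tabulate (λ j → 𝟙 (does (i <ᶠ? j))) (λ (j : Fin n) → j))

  _≟ᵉ_ : DecidableEquality (Fin n × Fin n)
  _≟ᵉ_ = ≡-dec _≟_ _≟_

  count-joins-slots-increasing : ∀ {a b} → a <ᶠ b → count (joins (a , b)) slots ≡ 1
  count-joins-slots-increasing {a} {b} a<b = trans
    (count-cong (All.map (λ {p} p< → does-⇔ (mk⇔ (≐⇒≡ p< a<b) λ { refl → ≐-refl })
                                            (p ≐? (a , b)) (p ≟ᵉ (a , b)))
                         slots-increasing))
    (count-≟-unique _≟ᵉ_ slots-unique (∈-slots⁺ a<b))

  count-joins-slots : ∀ {e} → NonLoop e → count (joins e) slots ≡ 1
  count-joins-slots {a , b} a≢b with <-cmp a b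
  ... | tri< a<b _ _ = count-joins-slots-increasing a<b
  ... | tri≈ _ a≡b _ = contradiction a≡b a≢b
  ... | tri> _ _ b<a = trans
    (count-cong {xs = slots} (All.tabulate λ {p} _ →
       does-⇔ (mk⇔ ≐-swapʳ ≐-swapʳ) (p ≐? (a , b)) (p ≐? (b , a))))
    (count-joins-slots-increasing b<a)

  DistinctEdges : (Fin n × Fin n) × (Fin n × Fin n) → Set
  DistinctEdges = uncurry (λ e f → NonLoop e × NonLoop f × ¬ e ≐ f)

  numEdges-twoEdgeGraph : ∀ {e f} → DistinctEdges (e , f) → numEdges (twoEdgeGraph e f) ≡ 2
  numEdges-twoEdgeGraph {e} {f} (e-nonLoop , f-nonLoop , e≭f) = begin
    numEdges (twoEdgeGraph e f)
      ≡⟨ numEdges≡count (twoEdgeGraph e f) ⟩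
    count (adjᵉ (twoEdgeGraph e f)) slots
      ≡⟨ count-cong (All.map (adjᵉ-twoEdgeGraph ∘ <⇒≢) slots-increasing) ⟩
    count (λ p → joins e p ∨ joins f p) slots
      ≡⟨ count-∨ (joins e) (joins f) slots (All.tabulate λ {p} _ → disjoint p) ⟩
    count (joins e) slots + count (joins f) slots
      ≡⟨ cong₂ _+_ (count-joins-slots e-nonLoop) (count-joins-slots f-nonLoop) ⟩
    2 ∎
    where
    open ≡-Reasoning
    disjoint : ∀ p → ¬ T (joins e p ∧ joins f p)
    disjoint p both with Equivalence.to (T-∧ {joins e p}) both
    ... | p~e , p~f = e≭f (≐-unique (T-does⁻ (p ≐? e) p~e) (T-does⁻ (p ≐? f) p~f))

  _⊆E?_ : (H X : Graph n) → Dec (H ⊆E X)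
  H ⊆E? X = all? λ i → all? λ j → T? (adj H i j) →-dec T? (adj X i j)

  _⊆ᵇ_ : Graph n → Graph n → Bool
  H ⊆ᵇ X = does (H ⊆E? X)

  ⊆ᵇ-twoEdgeGraph : ∀ {e f} → NonLoop e → NonLoop f → ∀ X →
                    (twoEdgeGraph e f ⊆ᵇ X) ≡ (adjᵉ X e ∧ adjᵉ X f)
  ⊆ᵇ-twoEdgeGraph {e} {f} e-nonLoop f-nonLoop X =
    does-⇔ (mk⇔ to from) (H ⊆E? X) (T? (adjᵉ X e ∧ adjᵉ X f))
    where
    H = twoEdgeGraph e f
    edge : ∀ {p} → NonLoop p → p ≐ e ⊎ p ≐ f → T (adjᵉ H p)
    edge {p} p-nonLoop p~ = subst T (sym (adjᵉ-twoEdgeGraph p-nonLoop))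
      (Equivalence.from (T-∨ {joins e p}) (Sum.map (T-does⁺ (p ≐? e)) (T-does⁺ (p ≐? f)) p~))
    to : H ⊆E X → T (adjᵉ X e ∧ adjᵉ X f)
    to H⊆X = Equivalence.from (T-∧ {adjᵉ X e})
               (H⊆X _ _ (edge e-nonLoop (inj₁ ≐-refl)) , H⊆X _ _ (edge f-nonLoop (inj₂ ≐-refl)))
    from : T (adjᵉ X e ∧ adjᵉ X f) → H ⊆E X
    from Xef i j Hij
      with Equivalence.to (T-∧ {adjᵉ X e}) Xef
         | Equivalence.to (T-∨ {joins e (i , j)}) (proj₂ (Equivalence.to (T-∧ {not (does (i ≟ j))}) Hij))
    ... | Xe , _  | inj₁ ij~e = subst T (sym (adjᵉ-resp-≐ X (T-does⁻ ((i , j) ≐? e) ij~e))) Xe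
    ... | _  , Xf | inj₂ ij~f = subst T (sym (adjᵉ-resp-≐ X (T-does⁻ ((i , j) ≐? f) ij~f))) Xf

  twoEdgeGraphs : List ((Fin n × Fin n) × (Fin n × Fin n)) → List (Graph n)
  twoEdgeGraphs = map (uncurry twoEdgeGraph)

  numEdges-twoEdgeGraphs : ∀ {ps} → All DistinctEdges ps → All (λ H → numEdges H ≡ 2) (twoEdgeGraphs ps)
  numEdges-twoEdgeGraphs = Allₚ.map⁺ ∘ All.map numEdges-twoEdgeGraph

  length-twoEdgeGraphs-pairs : ∀ es → length (twoEdgeGraphs (pairs es)) ≡ length es C 2
  length-twoEdgeGraphs-pairs es = trans (length-map (uncurry twoEdgeGraph) (pairs es)) (length-pairs es)

  count-⊆ᵇ-twoEdgeGraphs-pairs : ∀ es → All DistinctEdges (pairs es) → ∀ X →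
                                 count (_⊆ᵇ X) (twoEdgeGraphs (pairs es)) ≡ count (adjᵉ X) es C 2
  count-⊆ᵇ-twoEdgeGraphs-pairs es distinct X = begin
    count (_⊆ᵇ X) (twoEdgeGraphs (pairs es))
      ≡⟨ count-map (_⊆ᵇ X) (uncurry twoEdgeGraph) (pairs es) ⟩
    count ((_⊆ᵇ X) ∘ uncurry twoEdgeGraph) (pairs es)
      ≡⟨ count-cong (All.map (λ d → ⊆ᵇ-twoEdgeGraph (proj₁ d) (proj₁ (proj₂ d)) X) distinct) ⟩
    count (uncurry (λ e f → adjᵉ X e ∧ adjᵉ X f)) (pairs es)
      ≡⟨ count-pairs (adjᵉ X) es ⟩
    count (adjᵉ X) es C 2 ∎
    where open ≡-Reasoning

  allTwoEdgeGraphs : List (Graph n)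
  allTwoEdgeGraphs = twoEdgeGraphs (pairs slots)

  slots-distinct : All DistinctEdges (pairs slots)
  slots-distinct = All.map (λ (p< , q< , p≢q) → <⇒≢ p< , <⇒≢ q< , p≢q ∘ ≐⇒≡ p< q<)
                           (All-pairs⁺ slots-increasing slots-unique)

  numEdges-allTwoEdgeGraphs : All (λ H → numEdges H ≡ 2) allTwoEdgeGraphs
  numEdges-allTwoEdgeGraphs = numEdges-twoEdgeGraphs slots-distinct

  length-allTwoEdgeGraphs : length allTwoEdgeGraphs ≡ (n C 2) C 2
  length-allTwoEdgeGraphs = trans (length-twoEdgeGraphs-pairs slots) (cong (_C 2) length-slots)

  count-⊆ᵇ-allTwoEdgeGraphs : ∀ X → count (_⊆ᵇ X) allTwoEdgeGraphs ≡ numEdges X C 2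
  count-⊆ᵇ-allTwoEdgeGraphs X =
    trans (count-⊆ᵇ-twoEdgeGraphs-pairs slots slots-distinct X) (cong (_C 2) (sym (numEdges≡count X)))

  degree : Graph n → Fin n → ℕ
  degree X v = ∑[ u < n ] 𝟙 (adj X v u)

  cherryCount : Graph n → ℕ
  cherryCount X = ∑[ v < n ] (degree X v C 2)

  degree-≅ : ∀ {G X} → (iso : G ≅ X) → ∀ v → degree X (proj₁ iso ⟨$⟩ʳ v) ≡ degree G v
  degree-≅ {G} {X} (σ , σ-iso) v =
    trans (sum-permute (λ u → 𝟙 (adj X (σ ⟨$⟩ʳ v) u)) σ) (sum-cong-≗ (cong 𝟙 ∘ σ-iso v))

  cherryCount-≅ : ∀ {G X} → G ≅ X → cherryCount X ≡ cherryCount G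
  cherryCount-≅ {G} {X} iso@(σ , _) =
    trans (sum-permute (λ v → degree X v C 2) σ) (sum-cong-≗ (cong (_C 2) ∘ degree-≅ {G} {X} iso))

  -- Copies of a graph, up to equality of edge sets

  ≈G-setoid : Setoid _ _
  ≈G-setoid = record
    { Carrier       = Graph n
    ; _≈_           = _≈G_
    ; isEquivalence = record
      { refl  = λ _ _ → refl
      ; sym   = λ X≈Y i j → sym (X≈Y i j)
      ; trans = λ X≈Y Y≈Z i j → trans (X≈Y i j) (Y≈Z i j)
      }
    }

  _≈G?_ : Decidable (_≈G_ {n})
  X ≈G? Y = all? λ i → all? λ j → adj X i j Bool.≟ adj Y i j

  ≈G-decSetoid : DecSetoid _ _
  ≈G-decSetoid = record
    { isDecEquivalence = record { isEquivalence = Setoid.isEquivalence ≈G-setoid ; _≟_ = _≈G?_ } }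

  numEdges-resp-≈G : ∀ {X Y : Graph n} → X ≈G Y → numEdges X ≡ numEdges Y
  numEdges-resp-≈G {X} {Y} X≈Y = begin
    numEdges X              ≡⟨ numEdges≡count X ⟩
    count (adjᵉ X) slots    ≡⟨ count-cong {xs = slots} (All.tabulate λ {p} _ → X≈Y _ _) ⟩
    count (adjᵉ Y) slots    ≡⟨ numEdges≡count Y ⟨
    numEdges Y              ∎
    where open ≡-Reasoning

  ≅-respʳ-≈G : ∀ {G : Graph n} → (G ≅_) Respects _≈G_
  ≅-respʳ-≈G X≈Y (σ , σ-iso) = σ , λ i j → trans (sym (X≈Y _ _)) (σ-iso i j)

  ⊆E-respʳ-≈G : ∀ {H : Graph n} → (H ⊆E_) Respects _≈G_
  ⊆E-respʳ-≈G {H} {X} {Y} X≈Y H⊆X i j = subst T (X≈Y i j) ∘ H⊆X i j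

  -- Graphs related by _≈G_ are passed explicitly below: _≈G_ unfolds to a pointwise
  -- equation of adjacencies, from which Agda cannot infer them.
  module Copies {k lam : ℕ} {G : Graph n} (2≤k : 2 ≤ k)
    (balanced : ∀ (H : Graph n) → numEdges H ≡ 2 →
                HasExactly lam (λ X → numEdges X ≡ k × G ≅ X × H ⊆E X)) where

    open SetoidMembership ≈G-setoid using () renaming (_∈_ to _∈ₛ_)
    open SetoidUnique ≈G-setoid using () renaming (Unique to Uniqueₛ)

    Copy : Graph n → Set
    Copy X = numEdges X ≡ k × G ≅ X

    Copy-resp-≈G : Copy Respects _≈G_
    Copy-resp-≈G {X} {Y} X≈Y (X-edges , G≅X) =
      trans (sym (numEdges-resp-≈G {X} {Y} X≈Y)) X-edges , ≅-respʳ-≈G {G} {X} {Y} X≈Y G≅X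

    CopyContaining-resp-≈G : ∀ {H} → (λ X → numEdges X ≡ k × G ≅ X × H ⊆E X) Respects _≈G_
    CopyContaining-resp-≈G {H} {X} {Y} X≈Y (X-edges , G≅X , H⊆X) =
      let Y-edges , G≅Y = Copy-resp-≈G {X} {Y} X≈Y (X-edges , G≅X)
      in  Y-edges , G≅Y , ⊆E-respʳ-≈G {H} {X} {Y} X≈Y H⊆X

    copiesContaining : Graph n → List (Graph n)
    copiesContaining H with numEdges H ℕ.≟ 2
    ... | yes H₂ = proj₁ (balanced H H₂)
    ... | no  _  = []

    copiesContaining-sound : ∀ H → All Copy (copiesContaining H)
    copiesContaining-sound H with numEdges H ℕ.≟ 2
    ... | yes H₂ = All.map (λ (X-edges , G≅X , _) → X-edges , G≅X) (proj₁ (proj₂ (proj₂ (balanced H H₂))))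
    ... | no  _  = []

    copiesContaining-complete : ∀ {H X : Graph n} → numEdges H ≡ 2 → Copy X → H ⊆E X →
                                X ∈ₛ copiesContaining H
    copiesContaining-complete {H} {X} H₂ (X-edges , G≅X) H⊆X with numEdges H ℕ.≟ 2
    ... | yes H₂′ = proj₂ (proj₂ (proj₂ (proj₂ (balanced H H₂′)))) X (X-edges , G≅X , H⊆X)
    ... | no ¬H₂  = contradiction H₂ ¬H₂

    copies : List (Graph n)
    copies = deduplicate _≈G?_ (concatMap copiesContaining allTwoEdgeGraphs)

    copies-unique : Uniqueₛ copies
    copies-unique = deduplicate-! ≈G-decSetoid (concatMap copiesContaining allTwoEdgeGraphs)

    copies-sound : All Copy copies
    copies-sound = Allₚ.deduplicate⁺ _≈G?_
      (Allₚ.concat⁺ (Allₚ.map⁺ {xs = allTwoEdgeGraphs} (All.tabulate λ {H} _ → copiesContaining-sound H)))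

    copies-complete : ∀ {X : Graph n} → Copy X → X ∈ₛ copies
    copies-complete {X} copy@(X-edges , _) =
      Anyₚ.deduplicate⁺ _≈G?_ (λ Z≈Y X≈Y i j → trans (X≈Y i j) (sym (Z≈Y i j)))
        (Anyₚ.concat⁺ (Anyₚ.map⁺ (Any.map X∈copiesContaining (Any×All⇒Any some-H⊆X numEdges-allTwoEdgeGraphs))))
      where
      X∈copiesContaining : ∀ {H} → T (H ⊆ᵇ X) × numEdges H ≡ 2 → X ∈ₛ copiesContaining H
      X∈copiesContaining {H} (H⊆X , H₂) = copiesContaining-complete {H} {X} H₂ copy (T-does⁻ (H ⊆E? X) H⊆X)
      some-H⊆X : Any (T ∘ (_⊆ᵇ X)) allTwoEdgeGraphs
      some-H⊆X = count>0⇒Any (_⊆ᵇ X) allTwoEdgeGraphs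
        (subst (0 <_) (sym (trans (count-⊆ᵇ-allTwoEdgeGraphs X) (cong (_C 2) X-edges))) (nC2>0 2≤k))

    count-copies : ∀ {H : Graph n} → numEdges H ≡ 2 → count (H ⊆ᵇ_) copies ≡ lam
    count-copies {H} H₂ with balanced H H₂
    ... | L , |L|≡lam , L-sound , L-unique , L-complete = begin
      count (H ⊆ᵇ_) copies
        ≡⟨ length-filter≡count (H ⊆E?_) copies ⟨
      length (filter (H ⊆E?_) copies)
        ≡⟨ unique-⊆⊇⇒length-≡ ≈G-setoid (SetoidUniqueₚ.filter⁺ ≈G-setoid (H ⊆E?_) copies-unique) L-unique ⊆L L⊆ ⟩
      length L
        ≡⟨ |L|≡lam ⟩
      lam ∎
      where
      open ≡-Reasoning
      ⊆L : ∀ X → X ∈ₛ filter (H ⊆E?_) copies → X ∈ₛ L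
      ⊆L X X∈
        with SetoidMembershipₚ.∈-filter⁻ ≈G-setoid (H ⊆E?_) (λ {X} {Y} → ⊆E-respʳ-≈G {H} {X} {Y}) {v = X} X∈
      ... | X∈copies , H⊆X
        with All.lookupₛ ≈G-setoid (λ {X} {Y} → Copy-resp-≈G {X} {Y}) copies-sound {X} X∈copies
      ... | X-edges , G≅X = L-complete X (X-edges , G≅X , H⊆X)
      L⊆ : ∀ X → X ∈ₛ L → X ∈ₛ filter (H ⊆E?_) copies
      L⊆ X X∈L
        with All.lookupₛ ≈G-setoid (λ {X} {Y} → CopyContaining-resp-≈G {H} {X} {Y}) L-sound {X} X∈L
      ... | X-edges , G≅X , H⊆X =
        SetoidMembershipₚ.∈-filter⁺ ≈G-setoid (H ⊆E?_) (λ {X} {Y} → ⊆E-respʳ-≈G {H} {X} {Y}) {v = X}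
          (copies-complete {X} (X-edges , G≅X)) H⊆X

    double-count-copies : ∀ {Hs c} → All (λ H → numEdges H ≡ 2) Hs →
                          (∀ {X} → Copy X → count (_⊆ᵇ X) Hs ≡ c) →
                          length copies * c ≡ length Hs * lam
    double-count-copies Hs₂ count-Hs =
      double-count (λ X H → H ⊆ᵇ X) (All.map (λ {X} → count-Hs {X}) copies-sound)
                                    (All.map (λ {H} → count-copies {H}) Hs₂)

-- Cherries

module _ {m : ℕ} where

  -- punchIn v enumerates the vertices other than v.
  spokes : Fin (suc m) → List (Fin (suc m) × Fin (suc m))
  spokes v = tabulate (λ u → v , punchIn v u)

  spokes-distinct : ∀ v → All DistinctEdges (pairs (spokes v))
  spokes-distinct v =
    All-pairs⁺ (Allₚ.tabulate⁺ (λ u → punchInᵢ≢i v u ∘ sym)) (AllPairsₚ.tabulate⁺ different)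
    where
    different : ∀ {i j} → i ≢ j → ¬ (v , punchIn v i) ≐ (v , punchIn v j)
    different i≢j (inj₁ (_ , eq)) = i≢j (punchIn-injective v _ _ eq)
    different i≢j (inj₂ (v≡ , _)) = punchInᵢ≢i v _ (sym v≡)

  count-adjᵉ-spokes : ∀ X v → count (adjᵉ X) (spokes v) ≡ degree X v
  count-adjᵉ-spokes X v = begin
    count (adjᵉ X) (spokes v)
      ≡⟨ sum-map-tabulate (𝟙 ∘ adjᵉ X) (λ u → v , punchIn v u) ⟩
    ∑[ u < m ] 𝟙 (adj X v (punchIn v u))
      ≡⟨ cong (λ b → 𝟙 b + ∑[ u < m ] 𝟙 (adj X v (punchIn v u))) (irref X v) ⟨
    𝟙 (adj X v v) + ∑[ u < m ] 𝟙 (adj X v (punchIn v u))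
      ≡⟨ sum-remove {i = v} (λ u → 𝟙 (adj X v u)) ⟨
    degree X v ∎
    where open ≡-Reasoning

  cherriesAt : Fin (suc m) → List (Graph (suc m))
  cherriesAt v = twoEdgeGraphs (pairs (spokes v))

  cherries : List (Graph (suc m))
  cherries = concatMap cherriesAt (allFin (suc m))

  numEdges-cherries : All (λ H → numEdges H ≡ 2) cherries
  numEdges-cherries = Allₚ.concat⁺ (Allₚ.map⁺ (Allₚ.tabulate⁺ (numEdges-twoEdgeGraphs ∘ spokes-distinct)))

  length-cherries : length cherries ≡ suc m * (m C 2)
  length-cherries = begin
    length cherries
      ≡⟨ length-concatMap cherriesAt (allFin (suc m)) ⟩
    sum (map (length ∘ cherriesAt) (allFin (suc m)))
      ≡⟨ sum-map-const (Allₚ.tabulate⁺ {f = λ v → v} length-cherriesAt) ⟩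
    length (allFin (suc m)) * (m C 2)
      ≡⟨ cong (_* (m C 2)) (length-tabulate (λ (v : Fin (suc m)) → v)) ⟩
    suc m * (m C 2) ∎
    where
    open ≡-Reasoning
    length-cherriesAt : ∀ v → length (cherriesAt v) ≡ m C 2
    length-cherriesAt v = trans (length-twoEdgeGraphs-pairs (spokes v))
                                (cong (_C 2) (length-tabulate (λ u → v , punchIn v u)))

  count-⊆ᵇ-cherries : ∀ X → count (_⊆ᵇ X) cherries ≡ cherryCount X
  count-⊆ᵇ-cherries X = begin
    count (_⊆ᵇ X) cherries
      ≡⟨ sum-map-concatMap (𝟙 ∘ (_⊆ᵇ X)) cherriesAt (allFin (suc m)) ⟩
    sum (map (λ v → count (_⊆ᵇ X) (cherriesAt v)) (allFin (suc m)))
      ≡⟨ sum-map-tabulate (λ v → count (_⊆ᵇ X) (cherriesAt v)) (λ v → v) ⟩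
    ∑[ v < suc m ] count (_⊆ᵇ X) (cherriesAt v)
      ≡⟨ sum-cong-≗ count-cherriesAt ⟩
    cherryCount X ∎
    where
    open ≡-Reasoning
    count-cherriesAt : ∀ v → count (_⊆ᵇ X) (cherriesAt v) ≡ degree X v C 2
    count-cherriesAt v = trans (count-⊆ᵇ-twoEdgeGraphs-pairs (spokes v) (spokes-distinct v) X)
                               (cong (_C 2) (count-adjᵉ-spokes X v))

  balanced⇒cherryCount*[2+m]≡4*kC2 :
    ∀ {k lam} {G : Graph (suc m)} → 2 ≤ m → 2 ≤ k → 0 < lam →
    (∀ (H : Graph (suc m)) → numEdges H ≡ 2 →
       HasExactly lam (λ X → numEdges X ≡ k × G ≅ X × H ⊆E X)) →
    cherryCount G * suc (suc m) ≡ 4 * (k C 2)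
  balanced⇒cherryCount*[2+m]≡4*kC2 {k} {lam} {G} 2≤m 2≤k lam>0 balanced =
    proportional {length copies} {cherryCount G} {k C 2} {suc m * (m C 2)} {(suc m C 2) C 2} {lam} {suc (suc m)} {4}
      via-cherries via-allTwoEdgeGraphs (4*[[1+n]C2]C2≡[2+n]*[1+n]*nC2 m)
    where
    open Copies {k = k} {lam} {G} 2≤k balanced
    instance
      lam≢0 : NonZero lam
      lam≢0 = >-nonZero lam>0
      cherries≢0 : NonZero (suc m * (m C 2))
      cherries≢0 = m*n≢0 (suc m) (m C 2) ⦃ _ ⦄ ⦃ >-nonZero (nC2>0 2≤m) ⦄
    via-allTwoEdgeGraphs : length copies * (k C 2) ≡ ((suc m C 2) C 2) * lam
    via-allTwoEdgeGraphs = trans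
      (double-count-copies (numEdges-allTwoEdgeGraphs {suc m}) λ {X} (X-edges , _) →
         trans (count-⊆ᵇ-allTwoEdgeGraphs X) (cong (_C 2) X-edges))
      (cong (_* lam) (length-allTwoEdgeGraphs {suc m}))
    via-cherries : length copies * cherryCount G ≡ suc m * (m C 2) * lam
    via-cherries = trans
      (double-count-copies numEdges-cherries λ {X} (_ , G≅X) →
         trans (count-⊆ᵇ-cherries X) (cherryCount-≅ {G = G} {X} G≅X))
      (cong (_* lam) length-cherries)

mainTheorem2 : (n k : ℕ) → 4 ≤ n → 3 ≤ k → (G : Graph n) → numEdges G ≡ k →
    EdgeBalanced 2 k G → suc n ∣ 2 * k * (k ∸ 1)
mainTheorem2 (suc m) k (s≤s 3≤m) 3≤k G _ (_ , _ , _ , lam , lam>0 , balanced) =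
  divides (cherryCount G) (begin
    2 * k * (k ∸ 1)               ≡⟨ 2*n*[n∸1]≡4*nC2 k ⟩
    4 * (k C 2)                   ≡⟨ balanced⇒cherryCount*[2+m]≡4*kC2 {m} {G = G} 2≤m 2≤k lam>0 balanced ⟨
    cherryCount G * suc (suc m)   ∎)
  where
  open ≡-Reasoning
  2≤m = ≤-trans (n≤1+n 2) 3≤m
  2≤k = ≤-trans (n≤1+n 2) 3≤k
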